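{- Let $a_2,b_2\in\mathbb{R}$ and $a_1,b_1>0$. Let $[\mathcal{F}_{n,k}]_{n,k\ge0}$ be defined by $\mathcal{F}_{0,0}=1$, $\mathcal{F}_{n,k}=0$ unless $0\le k\le n$, and for $n\ge1$ $$\mathcal{F}_{n,k}=(a_1k+a_2)\mathcal{F}_{n-1,k}+(b_1k+b_2)\mathcal{F}_{n-1,k-1}.$$ Then for all $n,k\ge0$, $$\mathcal{F}_{n,k}=\binom{\frac{b_2}{b_1}+k}{k}\left(\frac{b_1}{a_1}\right)^k\sum_{j=0}^k\binom{k}{j}(-1)^{k-j}(a_2+a_1j)^n.$$
   Context: For real $r$ and integer $k\ge0$, $\binom{r}{k}=r(r-1)\cdots(r-k+1)/k!$; also $0^0=1$. -}

module Defs where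

open import Level using (Level; _⊔_) renaming (suc to lsuc)
open import Algebra.Bundles using (CommutativeRing)
open import Data.Nat as ℕ using (ℕ; zero; suc; _∸_)
open import Data.Nat.Combinatorics using (_C_)
import Data.Nat as N
open import Data.Product using (Σ; ∃; _×_)
open import Data.Sum using (_⊎_)
open import Relation.Nullary using (¬_)

-- An axiomatization of the real numbers: a complete ordered field.
-- (agda-stdlib has no real numbers; ℝ is, up to isomorphism, the unique
-- model of these axioms.)  The multiplicative inverse is a total function
-- whose value at 0 is unconstrained (only used at nonzero arguments).
record RealField (c ℓ : Level) : Set (lsuc (c ⊔ ℓ)) where
  field
    commRing : CommutativeRing c ℓ
  open CommutativeRing commRing public
  infix 4 _<_ _≤_
  field
    _⁻¹       : Carrier → Carrier
    ⁻¹-inverse : ∀ x → ¬ (x ≈ 0#) → x * (x ⁻¹) ≈ 1#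
    0≉1       : ¬ (0# ≈ 1#)
    _<_       : Carrier → Carrier → Set ℓ
    <-irrefl  : ∀ x → ¬ (x < x)
    <-trans   : ∀ {x y z} → x < y → y < z → x < z
    <-trichotomy : ∀ x y → (x < y) ⊎ ((x ≈ y) ⊎ (y < x))
    <-resp-≈  : ∀ {x x′ y y′} → x ≈ x′ → y ≈ y′ → x < y → x′ < y′
    +-mono-<  : ∀ {x y} z → x < y → x + z < y + z
    *-pos     : ∀ {x y} → 0# < x → 0# < y → 0# < x * y
  _≤_ : Carrier → Carrier → Set ℓ
  x ≤ y = (x < y) ⊎ (x ≈ y)
  field
    lub : (P : Carrier → Set c) → (∃ λ x → P x) →
          (∃ λ u → ∀ x → P x → x ≤ u) →
          ∃ λ s → (∀ x → P x → x ≤ s) × (∀ u → (∀ x → P x → x ≤ u) → s ≤ u)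

module _ {c ℓ : Level} (R : RealField c ℓ) where
  open RealField R

  ι : ℕ → Carrier
  ι zero    = 0#
  ι (suc n) = 1# + ι n

  -- x ^ n, with x ^ 0 = 1 (so 0 ^ 0 = 1)
  pow : Carrier → ℕ → Carrier
  pow x zero    = 1#
  pow x (suc n) = pow x n * x

  sumTo : ℕ → (ℕ → Carrier) → Carrier
  sumTo zero    f = f 0
  sumTo (suc k) f = sumTo k f + f (suc k)

  falling : Carrier → ℕ → Carrier
  falling r zero    = 1#
  falling r (suc k) = falling r k * (r - ι k)

  gbinom : Carrier → ℕ → Carrier
  gbinom r k = falling r k * (ι (N._! k) ⁻¹)

  _÷_ : Carrier → Carrier → Carrier
  x ÷ y = x * (y ⁻¹)

  F : (a1 a2 b1 b2 : Carrier) → ℕ → ℕ → Carrier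
  F a1 a2 b1 b2 zero    zero    = 1#
  F a1 a2 b1 b2 zero    (suc k) = 0#
  F a1 a2 b1 b2 (suc n) zero    = (a1 * ι 0 + a2) * F a1 a2 b1 b2 n 0
  F a1 a2 b1 b2 (suc n) (suc k) =
    (a1 * ι (suc k) + a2) * F a1 a2 b1 b2 n (suc k)
    + (b1 * ι (suc k) + b2) * F a1 a2 b1 b2 n k

  RHS : (a1 a2 b1 b2 : Carrier) → ℕ → ℕ → Carrier
  RHS a1 a2 b1 b2 n k =
    gbinom ((b2 ÷ b1) + ι k) k * pow (b1 ÷ a1) k *
    sumTo k (λ j → ι (k C j) * pow (- 1#) (k ∸ j) * pow (a2 + a1 * ι j) n)

-- Write Δ n k for the alternating sum Σⱼ (k C j) (−1)^(k−j) (a2 + a1 j)ⁿ and c k for the factor in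
-- front of it.  Pascal's rule together with (k + 1 − j) ((k+1) C j) = (k + 1) (k C j) gives
--   Δ (n+1) (k+1) = (a2 + a1 (k+1)) Δ n (k+1) + a1 (k+1) Δ n k,
-- while the generalized binomial coefficient satisfies c (k+1) · a1 (k+1) = c k · (b1 (k+1) + b2).
-- So c k · Δ n k obeys the recurrence of F; the initial values agree because the alternating sum
-- of a row of Pascal's triangle vanishes.  Positivity of a1 and b1 (and of k!) is only needed to
-- cancel inverses.

module Submission where

open import Defs
open import Level using (Level)
open import Data.Nat using (ℕ)

open import Data.Empty using (⊥-elim)
open import Data.Nat as ℕ using (zero; suc; _∸_; _!; NonZero)
import Data.Nat.Properties as ℕₚ
open import Data.Nat.Combinatorics using (_C_; nC1≡n; k>n⇒nCk≡0; nCk+nC[k+1]≡[n+1]C[k+1])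
open import Data.Nat.Tactic.RingSolver using (solve-∀)
open import Data.Sum using (inj₁; inj₂)
import Algebra.Properties.CommutativeSemigroup as CommSemigroupProperties
open import Function using (_∘_)
open import Relation.Binary.PropositionalEquality as ≡ using (_≡_; cong; cong₂)
open import Relation.Nullary using (¬_)

[k+1]*[n+1]C[k+1]≡[n+1]*nCk : ∀ n k → suc k ℕ.* (suc n C suc k) ≡ suc n ℕ.* (n C k)
[k+1]*[n+1]C[k+1]≡[n+1]*nCk n zero = begin
  1 ℕ.* (suc n C 1)   ≡⟨ ℕₚ.*-identityˡ _ ⟩
  suc n C 1           ≡⟨ nC1≡n (suc n) ⟩
  suc n               ≡⟨ ℕₚ.*-identityʳ (suc n) ⟨
  suc n ℕ.* (n C 0)   ∎
  where open ≡.≡-Reasoning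
[k+1]*[n+1]C[k+1]≡[n+1]*nCk zero (suc k) = ℕₚ.*-zeroʳ (suc (suc k))
[k+1]*[n+1]C[k+1]≡[n+1]*nCk (suc n) (suc k) = begin
  suc (suc k) ℕ.* (suc (suc n) C suc (suc k))
    ≡⟨ cong (suc (suc k) ℕ.*_) (nCk+nC[k+1]≡[n+1]C[k+1] (suc n) (suc k)) ⟨
  suc (suc k) ℕ.* (suc n C suc k ℕ.+ suc n C suc (suc k))
    ≡⟨ expand k (suc n C suc k) (suc n C suc (suc k)) ⟩
  suc n C suc k ℕ.+ suc k ℕ.* (suc n C suc k) ℕ.+ suc (suc k) ℕ.* (suc n C suc (suc k))
    ≡⟨ cong₂ (λ u v → suc n C suc k ℕ.+ u ℕ.+ v)
         ([k+1]*[n+1]C[k+1]≡[n+1]*nCk n k) ([k+1]*[n+1]C[k+1]≡[n+1]*nCk n (suc k)) ⟩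
  suc n C suc k ℕ.+ suc n ℕ.* (n C k) ℕ.+ suc n ℕ.* (n C suc k)
    ≡⟨ ℕₚ.+-assoc (suc n C suc k) _ _ ⟩
  suc n C suc k ℕ.+ (suc n ℕ.* (n C k) ℕ.+ suc n ℕ.* (n C suc k))
    ≡⟨ cong (suc n C suc k ℕ.+_) (ℕₚ.*-distribˡ-+ (suc n) (n C k) (n C suc k)) ⟨
  suc n C suc k ℕ.+ suc n ℕ.* (n C k ℕ.+ n C suc k)
    ≡⟨ cong (λ u → suc n C suc k ℕ.+ suc n ℕ.* u) (nCk+nC[k+1]≡[n+1]C[k+1] n k) ⟩
  suc (suc n) ℕ.* (suc n C suc k) ∎
  where
  open ≡.≡-Reasoning
  expand : ∀ k x y → suc (suc k) ℕ.* (x ℕ.+ y) ≡ x ℕ.+ suc k ℕ.* x ℕ.+ suc (suc k) ℕ.* y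
  expand = solve-∀

-- (n + 1 − k) ((n+1) C k) = (n + 1) (n C k), stated without truncated subtraction.
k*[n+1]Ck+[n+1]*nCk≡[n+1]*[n+1]Ck : ∀ n k → k ℕ.* (suc n C k) ℕ.+ suc n ℕ.* (n C k) ≡ suc n ℕ.* (suc n C k)
k*[n+1]Ck+[n+1]*nCk≡[n+1]*[n+1]Ck n zero = ≡.refl
k*[n+1]Ck+[n+1]*nCk≡[n+1]*[n+1]Ck n (suc k) = begin
  suc k ℕ.* (suc n C suc k) ℕ.+ suc n ℕ.* (n C suc k)
    ≡⟨ cong (ℕ._+ suc n ℕ.* (n C suc k)) ([k+1]*[n+1]C[k+1]≡[n+1]*nCk n k) ⟩
  suc n ℕ.* (n C k) ℕ.+ suc n ℕ.* (n C suc k)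
    ≡⟨ ℕₚ.*-distribˡ-+ (suc n) (n C k) (n C suc k) ⟨
  suc n ℕ.* (n C k ℕ.+ n C suc k)
    ≡⟨ cong (suc n ℕ.*_) (nCk+nC[k+1]≡[n+1]C[k+1] n k) ⟩
  suc n ℕ.* (suc n C suc k) ∎
  where open ≡.≡-Reasoning

module _ {ℓ₁ ℓ₂} (R : RealField ℓ₁ ℓ₂) where
  open RealField R
  open import Algebra.Properties.Ring ring using (-0#≈0#; -1*x≈-x; -‿involutive)
  open import Algebra.Properties.AbelianGroup +-abelianGroup using (⁻¹-∙-comm)
  open import Algebra.Properties.Semiring.Mult semiring using (_×_; ×-homo-+; ×1-homo-*)
  open import Algebra.Solver.Ring.NaturalCoefficients.Default commutativeSemiring
    using (solve; _:=_; _:+_; _:*_)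
  open import Relation.Binary.Reasoning.Setoid setoid

  private
    module +-Comm = CommSemigroupProperties +-commutativeSemigroup
    module *-Comm = CommSemigroupProperties *-commutativeSemigroup

  ι≈×1 : ∀ n → ι R n ≈ n × 1#
  ι≈×1 zero    = refl
  ι≈×1 (suc n) = +-cong refl (ι≈×1 n)

  ι-homo-+ : ∀ m n → ι R (m ℕ.+ n) ≈ ι R m + ι R n
  ι-homo-+ m n = trans (ι≈×1 (m ℕ.+ n)) (trans (×-homo-+ 1# m n) (sym (+-cong (ι≈×1 m) (ι≈×1 n))))

  ι-homo-* : ∀ m n → ι R (m ℕ.* n) ≈ ι R m * ι R n
  ι-homo-* m n = trans (ι≈×1 (m ℕ.* n)) (trans (×1-homo-* m n) (sym (*-cong (ι≈×1 m) (ι≈×1 n))))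

  sign-cancel : ∀ x → x * - 1# + x ≈ 0#
  sign-cancel x = trans (+-cong (trans (*-comm x (- 1#)) (-1*x≈-x x)) refl) (-‿inverseˡ x)

  0<1 : 0# < 1#
  0<1 with <-trichotomy 0# 1#
  ... | inj₁ 0<1 = 0<1
  ... | inj₂ (inj₁ 0≈1) = ⊥-elim (0≉1 0≈1)
  ... | inj₂ (inj₂ 1<0) =
    ⊥-elim (<-irrefl 0# (<-trans (<-resp-≈ refl [-1]*[-1]≈1 (*-pos 0<-1 0<-1)) 1<0))
    where
    0<-1 : 0# < - 1#
    0<-1 = <-resp-≈ (-‿inverseʳ 1#) (+-identityˡ (- 1#)) (+-mono-< (- 1#) 1<0)
    [-1]*[-1]≈1 : - 1# * - 1# ≈ 1#
    [-1]*[-1]≈1 = trans (-1*x≈-x (- 1#)) (-‿involutive 1#)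

  0<⇒≉0 : ∀ {x} → 0# < x → ¬ x ≈ 0#
  0<⇒≉0 0<x x≈0 = <-irrefl 0# (<-resp-≈ refl x≈0 0<x)

  0<ι[1+n] : ∀ n → 0# < ι R (suc n)
  0<ι[1+n] zero    = <-resp-≈ refl (sym (+-identityʳ 1#)) 0<1
  0<ι[1+n] (suc n) = <-trans (0<ι[1+n] n) (<-resp-≈ (+-identityˡ _) refl (+-mono-< (ι R (suc n)) 0<1))

  ι≉0 : ∀ n → .{{NonZero n}} → ¬ ι R n ≈ 0#
  ι≉0 (suc n) = 0<⇒≉0 (0<ι[1+n] n)

  ⁻¹-inverseˡ : ∀ {x} → ¬ x ≈ 0# → x ⁻¹ * x ≈ 1#
  ⁻¹-inverseˡ x≉0 = trans (*-comm _ _) (⁻¹-inverse _ x≉0)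

  -- _⁻¹ is not assumed to respect _≈_, so the product v * u is passed as any w ≈ v * u.
  v*w⁻¹≈u⁻¹ : ∀ {u v w} → w ≈ v * u → ¬ u ≈ 0# → ¬ w ≈ 0# → v * w ⁻¹ ≈ u ⁻¹
  v*w⁻¹≈u⁻¹ {u} {v} {w} w≈vu u≉0 w≉0 = begin
    v * w ⁻¹                 ≈⟨ *-identityʳ _ ⟨
    v * w ⁻¹ * 1#            ≈⟨ *-cong refl (⁻¹-inverse u u≉0) ⟨
    v * w ⁻¹ * (u * u ⁻¹)    ≈⟨ regroup v (w ⁻¹) u (u ⁻¹) ⟩
    (v * u) * w ⁻¹ * u ⁻¹    ≈⟨ *-cong (*-cong w≈vu refl) refl ⟨
    w * w ⁻¹ * u ⁻¹          ≈⟨ *-cong (⁻¹-inverse w w≉0) refl ⟩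
    1# * u ⁻¹                ≈⟨ *-identityˡ _ ⟩
    u ⁻¹                     ∎
    where
    regroup : ∀ v w′ u u′ → v * w′ * (u * u′) ≈ (v * u) * w′ * u′
    regroup = solve 4 (λ v w′ u u′ → v :* w′ :* (u :* u′) := (v :* u) :* w′ :* u′) refl

  sumTo-cong : ∀ k {f g : ℕ → Carrier} → (∀ {j} → j ℕ.≤ k → f j ≈ g j) → sumTo R k f ≈ sumTo R k g
  sumTo-cong zero    f≈g = f≈g ℕ.z≤n
  sumTo-cong (suc k) f≈g = +-cong (sumTo-cong k (f≈g ∘ ℕₚ.m≤n⇒m≤1+n)) (f≈g ℕₚ.≤-refl)

  sumTo-0# : ∀ k → sumTo R k (λ _ → 0#) ≈ 0#
  sumTo-0# zero    = refl
  sumTo-0# (suc k) = trans (+-cong (sumTo-0# k) refl) (+-identityʳ 0#)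

  sumTo-+ : ∀ k (f g : ℕ → Carrier) → sumTo R k (λ j → f j + g j) ≈ sumTo R k f + sumTo R k g
  sumTo-+ zero    f g = refl
  sumTo-+ (suc k) f g = trans (+-cong (sumTo-+ k f g) refl) (+-Comm.interchange _ _ _ _)

  sumTo-*ˡ : ∀ k u (f : ℕ → Carrier) → sumTo R k (λ j → u * f j) ≈ u * sumTo R k f
  sumTo-*ˡ zero    u f = refl
  sumTo-*ˡ (suc k) u f = trans (+-cong (sumTo-*ˡ k u f) refl) (sym (distribˡ u _ _))

  sumTo-suc : ∀ k (f : ℕ → Carrier) → sumTo R (suc k) f ≈ f 0 + sumTo R k (f ∘ suc)
  sumTo-suc zero    f = refl
  sumTo-suc (suc k) f = trans (+-cong (sumTo-suc k f) refl) (+-assoc _ _ _)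

  sumTo-pascal : ∀ k (f : ℕ → Carrier) →
    sumTo R (suc k) (λ j → ι R (suc k C j) * f j) ≈ sumTo R k (λ j → ι R (k C j) * (f j + f (suc j)))
  sumTo-pascal k f = begin
    sumTo R (suc k) (λ j → ι R (suc k C j) * f j)
      ≈⟨ sumTo-suc k _ ⟩
    g 0 + sumTo R k (λ j → ι R (suc k C suc j) * f (suc j))
      ≈⟨ +-cong refl (sumTo-cong k (λ {j} _ → pascal j)) ⟩
    g 0 + sumTo R k (λ j → ι R (k C j) * f (suc j) + g (suc j))
      ≈⟨ +-cong refl (sumTo-+ k _ _) ⟩
    g 0 + (sumTo R k (λ j → ι R (k C j) * f (suc j)) + sumTo R k (g ∘ suc))
      ≈⟨ +-Comm.x∙yz≈y∙xz _ _ _ ⟩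
    sumTo R k (λ j → ι R (k C j) * f (suc j)) + (g 0 + sumTo R k (g ∘ suc))
      ≈⟨ +-cong refl (sumTo-suc k g) ⟨
    sumTo R k (λ j → ι R (k C j) * f (suc j)) + (sumTo R k g + g (suc k))
      ≈⟨ +-cong refl (trans (+-cong refl g[1+k]≈0) (+-identityʳ _)) ⟩
    sumTo R k (λ j → ι R (k C j) * f (suc j)) + sumTo R k g
      ≈⟨ +-comm _ _ ⟩
    sumTo R k g + sumTo R k (λ j → ι R (k C j) * f (suc j))
      ≈⟨ sumTo-+ k _ _ ⟨
    sumTo R k (λ j → g j + ι R (k C j) * f (suc j))
      ≈⟨ sumTo-cong k (λ _ → sym (distribˡ _ _ _)) ⟩
    sumTo R k (λ j → ι R (k C j) * (f j + f (suc j))) ∎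
    where
    g : ℕ → Carrier
    g j = ι R (k C j) * f j
    pascal : ∀ j → ι R (suc k C suc j) * f (suc j) ≈ ι R (k C j) * f (suc j) + g (suc j)
    pascal j = begin
      ι R (suc k C suc j) * f (suc j)
        ≡⟨ cong (λ m → ι R m * f (suc j)) (nCk+nC[k+1]≡[n+1]C[k+1] k j) ⟨
      ι R (k C j ℕ.+ k C suc j) * f (suc j)
        ≈⟨ *-cong (ι-homo-+ (k C j) (k C suc j)) refl ⟩
      (ι R (k C j) + ι R (k C suc j)) * f (suc j)
        ≈⟨ distribʳ _ _ _ ⟩
      ι R (k C j) * f (suc j) + g (suc j) ∎
    g[1+k]≈0 : g (suc k) ≈ 0#
    g[1+k]≈0 = trans (*-cong (reflexive (cong (ι R) (k>n⇒nCk≡0 (ℕₚ.n<1+n k)))) refl) (zeroˡ _)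

  ι-absorption : ∀ k j → ι R j * ι R (suc k C j) + ι R (suc k) * ι R (k C j) ≈ ι R (suc k) * ι R (suc k C j)
  ι-absorption k j = begin
    ι R j * ι R (suc k C j) + ι R (suc k) * ι R (k C j)
      ≈⟨ +-cong (ι-homo-* j (suc k C j)) (ι-homo-* (suc k) (k C j)) ⟨
    ι R (j ℕ.* (suc k C j)) + ι R (suc k ℕ.* (k C j))
      ≈⟨ ι-homo-+ (j ℕ.* (suc k C j)) (suc k ℕ.* (k C j)) ⟨
    ι R (j ℕ.* (suc k C j) ℕ.+ suc k ℕ.* (k C j))
      ≡⟨ cong (ι R) (k*[n+1]Ck+[n+1]*nCk≡[n+1]*[n+1]Ck k j) ⟩
    ι R (suc k ℕ.* (suc k C j))
      ≈⟨ ι-homo-* (suc k) (suc k C j) ⟩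
    ι R (suc k) * ι R (suc k C j) ∎

  module _ (a1 a2 : Carrier) where

    node : ℕ → Carrier
    node j = a2 + a1 * ι R j

    summand : ℕ → ℕ → ℕ → Carrier
    summand n k j = ι R (k C j) * pow R (- 1#) (k ∸ j) * pow R (node j) n

    -- Δ n k is the k-th forward difference at 0 of j ↦ (a2 + a1 j)ⁿ.
    Δ : ℕ → ℕ → Carrier
    Δ n k = sumTo R k (summand n k)

    Δ-zero-zero : Δ 0 0 ≈ 1#
    Δ-zero-zero = trans (*-identityʳ _) (trans (*-identityʳ _) (+-identityʳ 1#))

    Δ-zero-suc : ∀ k → Δ 0 (suc k) ≈ 0#
    Δ-zero-suc k = begin
      Δ 0 (suc k)
        ≈⟨ sumTo-cong (suc k) (λ _ → *-identityʳ _) ⟩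
      sumTo R (suc k) (λ j → ι R (suc k C j) * pow R (- 1#) (suc k ∸ j))
        ≈⟨ sumTo-pascal k _ ⟩
      sumTo R k (λ j → ι R (k C j) * (pow R (- 1#) (suc k ∸ j) + pow R (- 1#) (k ∸ j)))
        ≈⟨ sumTo-cong k (λ j≤k → trans (*-cong refl (alternate j≤k)) (zeroʳ _)) ⟩
      sumTo R k (λ _ → 0#)
        ≈⟨ sumTo-0# k ⟩
      0# ∎
      where
      alternate : ∀ {j} → j ℕ.≤ k → pow R (- 1#) (suc k ∸ j) + pow R (- 1#) (k ∸ j) ≈ 0#
      alternate {j} j≤k rewrite ℕₚ.+-∸-assoc 1 j≤k = sign-cancel (pow R (- 1#) (k ∸ j))

    summand-suc : ∀ n k j → summand (suc n) k j ≈ node j * summand n k j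
    summand-suc n k j = reassoc (ι R (k C j)) (pow R (- 1#) (k ∸ j)) (pow R (node j) n) (node j)
      where
      reassoc : ∀ c s p x → c * s * (p * x) ≈ x * (c * s * p)
      reassoc = solve 4 (λ c s p x → c :* s :* (p :* x) := x :* (c :* s :* p)) refl

    Δ-suc-zero : ∀ n → Δ (suc n) 0 ≈ node 0 * Δ n 0
    Δ-suc-zero n = summand-suc n 0 0

    summand-suc-suc : ∀ n k {j} → j ℕ.≤ k →
      summand (suc n) (suc k) j ≈ node (suc k) * summand n (suc k) j + (a1 * ι R (suc k)) * summand n k j
    -- Split a2 + a1 j = (a2 + a1 (k+1)) − a1 (k+1−j); ι-absorption turns the second part into a1 (k+1) (k C j).
    summand-suc-suc n k {j} j≤k = begin
      B′ * pow R s (suc k ∸ j) * (P * node j)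
        ≡⟨ cong (λ e → B′ * e * (P * node j)) sign-step ⟩
      B′ * (E * s) * (P * (a2 + a1 * J))
        ≈⟨ +-identityʳ _ ⟨
      B′ * (E * s) * (P * (a2 + a1 * J)) + 0#
        ≈⟨ +-cong refl (trans (*-cong refl (sign-cancel (V * B))) (zeroʳ _)) ⟨
      B′ * (E * s) * (P * (a2 + a1 * J)) + a1 * E * P * (V * B * s + V * B)
        ≈⟨ expand a1 a2 J V B′ B E P s ⟩
      a2 * (B′ * (E * s) * P) + a1 * E * P * ((J * B′ + V * B) * s + V * B)
        ≈⟨ +-cong refl (*-cong refl (+-cong (*-cong (ι-absorption k j) refl) refl)) ⟩
      a2 * (B′ * (E * s) * P) + a1 * E * P * (V * B′ * s + V * B)
        ≈⟨ collect a1 a2 V B′ B E P s ⟩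
      (a2 + a1 * V) * (B′ * (E * s) * P) + a1 * V * (B * E * P)
        ≡⟨ cong (λ e → node (suc k) * (B′ * e * P) + a1 * V * (B * E * P)) sign-step ⟨
      node (suc k) * summand n (suc k) j + (a1 * V) * summand n k j ∎
      where
      s = - 1#
      V = ι R (suc k)
      J = ι R j
      B′ = ι R (suc k C j)
      B = ι R (k C j)
      E = pow R s (k ∸ j)
      P = pow R (node j) n
      sign-step : pow R s (suc k ∸ j) ≡ E * s
      sign-step = cong (pow R s) (ℕₚ.+-∸-assoc 1 j≤k)
      expand : ∀ a1 a2 J V B′ B E P s →
        B′ * (E * s) * (P * (a2 + a1 * J)) + a1 * E * P * (V * B * s + V * B)
          ≈ a2 * (B′ * (E * s) * P) + a1 * E * P * ((J * B′ + V * B) * s + V * B)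
      expand = solve 9 (λ a1 a2 J V B′ B E P s →
        B′ :* (E :* s) :* (P :* (a2 :+ a1 :* J)) :+ a1 :* E :* P :* (V :* B :* s :+ V :* B)
          := a2 :* (B′ :* (E :* s) :* P) :+ a1 :* E :* P :* ((J :* B′ :+ V :* B) :* s :+ V :* B)) refl
      collect : ∀ a1 a2 V B′ B E P s →
        a2 * (B′ * (E * s) * P) + a1 * E * P * (V * B′ * s + V * B)
          ≈ (a2 + a1 * V) * (B′ * (E * s) * P) + a1 * V * (B * E * P)
      collect = solve 8 (λ a1 a2 V B′ B E P s →
        a2 :* (B′ :* (E :* s) :* P) :+ a1 :* E :* P :* (V :* B′ :* s :+ V :* B)
          := (a2 :+ a1 :* V) :* (B′ :* (E :* s) :* P) :+ a1 :* V :* (B :* E :* P)) refl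

    Δ-suc-suc : ∀ n k → Δ (suc n) (suc k) ≈ node (suc k) * Δ n (suc k) + (a1 * ι R (suc k)) * Δ n k
    Δ-suc-suc n k = begin
      sumTo R k (summand (suc n) (suc k)) + summand (suc n) (suc k) (suc k)
        ≈⟨ +-cong (sumTo-cong k (summand-suc-suc n k)) (summand-suc n (suc k) (suc k)) ⟩
      sumTo R k (λ j → Y * summand n (suc k) j + Q * summand n k j) + Y * summand n (suc k) (suc k)
        ≈⟨ +-cong (trans (sumTo-+ k _ _) (+-cong (sumTo-*ˡ k Y _) (sumTo-*ˡ k Q _))) refl ⟩
      Y * sumTo R k (summand n (suc k)) + Q * Δ n k + Y * summand n (suc k) (suc k)
        ≈⟨ regroup Y (sumTo R k (summand n (suc k))) Q (Δ n k) (summand n (suc k) (suc k)) ⟩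
      Y * Δ n (suc k) + Q * Δ n k ∎
      where
      Y = node (suc k)
      Q = a1 * ι R (suc k)
      regroup : ∀ y s q d t → y * s + q * d + y * t ≈ y * (s + t) + q * d
      regroup = solve 5 (λ y s q d t → y :* s :+ q :* d :+ y :* t := y :* (s :+ t) :+ q :* d) refl

  falling-cong : ∀ k {r r′} → r ≈ r′ → falling R r k ≈ falling R r′ k
  falling-cong zero    r≈r′ = refl
  falling-cong (suc k) r≈r′ = *-cong (falling-cong k r≈r′) (+-cong r≈r′ refl)

  falling-suc : ∀ r k → falling R (1# + r) (suc k) ≈ (1# + r) * falling R r k
  falling-suc r zero = begin
    1# * ((1# + r) - 0#)  ≈⟨ *-identityˡ _ ⟩
    (1# + r) - 0#         ≈⟨ +-cong refl -0#≈0# ⟩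
    (1# + r) + 0#         ≈⟨ +-identityʳ _ ⟩
    1# + r                ≈⟨ *-identityʳ _ ⟨
    (1# + r) * 1#         ∎
  falling-suc r (suc k) = begin
    falling R (1# + r) (suc k) * ((1# + r) - (1# + ι R k))
      ≈⟨ *-cong (falling-suc r k) shift-cancel ⟩
    (1# + r) * falling R r k * (r - ι R k)
      ≈⟨ *-assoc _ _ _ ⟩
    (1# + r) * (falling R r k * (r - ι R k)) ∎
    where
    shift-cancel : (1# + r) - (1# + ι R k) ≈ r - ι R k
    shift-cancel = begin
      (1# + r) - (1# + ι R k)        ≈⟨ +-cong refl (⁻¹-∙-comm 1# (ι R k)) ⟨
      (1# + r) + (- 1# + - ι R k)    ≈⟨ +-Comm.interchange 1# r (- 1#) (- ι R k) ⟩
      (1# + - 1#) + (r - ι R k)      ≈⟨ +-cong (-‿inverseʳ 1#) refl ⟩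
      0# + (r - ι R k)               ≈⟨ +-identityˡ _ ⟩
      r - ι R k                      ∎

  coefficient : (a1 b1 b2 : Carrier) → ℕ → Carrier
  coefficient a1 b1 b2 k = gbinom R (_÷_ R b2 b1 + ι R k) k * pow R (_÷_ R b1 a1) k

  coefficient-zero : ∀ a1 b1 b2 → coefficient a1 b1 b2 0 ≈ 1#
  coefficient-zero a1 b1 b2 = begin
    1# * ι R 1 ⁻¹ * 1#    ≈⟨ *-identityʳ _ ⟩
    1# * ι R 1 ⁻¹         ≈⟨ *-cong (+-identityʳ 1#) refl ⟨
    ι R 1 * ι R 1 ⁻¹      ≈⟨ ⁻¹-inverse _ (ι≉0 1) ⟩
    1#                    ∎

  coefficient-suc : ∀ {a1 b1} b2 → 0# < a1 → 0# < b1 → ∀ k →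
    coefficient a1 b1 b2 (suc k) * (a1 * ι R (suc k)) ≈ coefficient a1 b1 b2 k * (b1 * ι R (suc k) + b2)
  coefficient-suc {a1} {b1} b2 0<a1 0<b1 k = begin
    falling R r′ (suc k) * W ⁻¹ * (pow R q k * q) * (a1 * V)
      ≈⟨ *-cong (*-cong (*-cong (trans (falling-cong (suc k) r′≈1+r) (falling-suc r k)) refl) refl) refl ⟩
    (1# + r) * f * W ⁻¹ * (pow R q k * q) * (a1 * V)
      ≈⟨ regroup (1# + r) f (W ⁻¹) (pow R q k) b1 (a1 ⁻¹) a1 V ⟩
    f * pow R q k * ((1# + r) * b1) * (V * W ⁻¹) * (a1 ⁻¹ * a1)
      ≈⟨ *-cong (*-cong (*-cong refl [1+r]*b1≈Z) V*W⁻¹≈U⁻¹) (⁻¹-inverseˡ (0<⇒≉0 0<a1)) ⟩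
    f * pow R q k * Z * U ⁻¹ * 1#
      ≈⟨ *-identityʳ _ ⟩
    f * pow R q k * Z * U ⁻¹
      ≈⟨ *-Comm.xy∙z≈xz∙y (f * pow R q k) Z (U ⁻¹) ⟩
    f * pow R q k * U ⁻¹ * Z
      ≈⟨ *-cong (*-Comm.xy∙z≈xz∙y f (pow R q k) (U ⁻¹)) refl ⟩
    f * U ⁻¹ * pow R q k * Z ∎
    where
    r = _÷_ R b2 b1 + ι R k
    r′ = _÷_ R b2 b1 + ι R (suc k)
    f = falling R r k
    q = _÷_ R b1 a1
    V = ι R (suc k)
    U = ι R (k !)
    W = ι R (suc k !)
    Z = b1 * V + b2
    r′≈1+r : r′ ≈ 1# + r
    r′≈1+r = +-Comm.x∙yz≈y∙xz (_÷_ R b2 b1) 1# (ι R k)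
    [1+r]*b1≈Z : (1# + r) * b1 ≈ Z
    [1+r]*b1≈Z = begin
      (1# + (b2 * b1 ⁻¹ + ι R k)) * b1        ≈⟨ expand 1# b2 (b1 ⁻¹) (ι R k) b1 ⟩
      b1 * (1# + ι R k) + b2 * (b1 ⁻¹ * b1)   ≈⟨ +-cong refl (*-cong refl (⁻¹-inverseˡ (0<⇒≉0 0<b1))) ⟩
      b1 * V + b2 * 1#                        ≈⟨ +-cong refl (*-identityʳ b2) ⟩
      Z                                       ∎
      where
      expand : ∀ o d e u b → (o + (d * e + u)) * b ≈ b * (o + u) + d * (e * b)
      expand = solve 5 (λ o d e u b → (o :+ (d :* e :+ u)) :* b := b :* (o :+ u) :+ d :* (e :* b)) refl
    V*W⁻¹≈U⁻¹ : V * W ⁻¹ ≈ U ⁻¹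
    V*W⁻¹≈U⁻¹ = v*w⁻¹≈u⁻¹ (ι-homo-* (suc k) (k !)) (ι≉0 (k !) {{k ℕₚ.!≢0}}) (ι≉0 (suc k !) {{suc k ℕₚ.!≢0}})
    regroup : ∀ x f w p b a′ a v → x * f * w * (p * (b * a′)) * (a * v) ≈ f * p * (x * b) * (v * w) * (a′ * a)
    regroup = solve 8 (λ x f w p b a′ a v →
      x :* f :* w :* (p :* (b :* a′)) :* (a :* v) := f :* p :* (x :* b) :* (v :* w) :* (a′ :* a)) refl

  F≈coefficient*Δ : ∀ {a1 b1} a2 b2 → 0# < a1 → 0# < b1 → ∀ n k →
    F R a1 a2 b1 b2 n k ≈ coefficient a1 b1 b2 k * Δ a1 a2 n k
  F≈coefficient*Δ {a1} {b1} a2 b2 0<a1 0<b1 = go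
    where
    c = coefficient a1 b1 b2
    go : ∀ n k → F R a1 a2 b1 b2 n k ≈ c k * Δ a1 a2 n k
    go zero zero = sym (trans (*-cong (coefficient-zero a1 b1 b2) (Δ-zero-zero a1 a2)) (*-identityˡ 1#))
    go zero (suc k) = sym (trans (*-cong refl (Δ-zero-suc a1 a2 k)) (zeroʳ _))
    go (suc n) zero = begin
      (a1 * ι R 0 + a2) * F R a1 a2 b1 b2 n 0      ≈⟨ *-cong refl (go n 0) ⟩
      (a1 * ι R 0 + a2) * (c 0 * Δ a1 a2 n 0)      ≈⟨ *-Comm.x∙yz≈y∙xz _ _ _ ⟩
      c 0 * ((a1 * ι R 0 + a2) * Δ a1 a2 n 0)      ≈⟨ *-cong refl (*-cong (+-comm _ _) refl) ⟩
      c 0 * (node a1 a2 0 * Δ a1 a2 n 0)           ≈⟨ *-cong refl (Δ-suc-zero a1 a2 n) ⟨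
      c 0 * Δ a1 a2 (suc n) 0                      ∎
    go (suc n) (suc k) = begin
      (a1 * V + a2) * F R a1 a2 b1 b2 n (suc k) + (b1 * V + b2) * F R a1 a2 b1 b2 n k
        ≈⟨ +-cong (*-cong refl (go n (suc k))) (*-cong refl (go n k)) ⟩
      (a1 * V + a2) * (c (suc k) * D′) + (b1 * V + b2) * (c k * D)
        ≈⟨ +-cong refl (trans (*-Comm.x∙yz≈yx∙z _ _ _) (*-cong (sym (coefficient-suc b2 0<a1 0<b1 k)) refl)) ⟩
      (a1 * V + a2) * (c (suc k) * D′) + c (suc k) * (a1 * V) * D
        ≈⟨ collect (a1 * V) a2 (c (suc k)) D′ D ⟩
      c (suc k) * (node a1 a2 (suc k) * D′ + a1 * V * D)
        ≈⟨ *-cong refl (Δ-suc-suc a1 a2 n k) ⟨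
      c (suc k) * Δ a1 a2 (suc n) (suc k) ∎
      where
      V = ι R (suc k)
      D′ = Δ a1 a2 n (suc k)
      D = Δ a1 a2 n k
      collect : ∀ y a2 c d′ d → (y + a2) * (c * d′) + c * y * d ≈ c * ((a2 + y) * d′ + y * d)
      collect = solve 5 (λ y a2 c d′ d → (y :+ a2) :* (c :* d′) :+ c :* y :* d := c :* ((a2 :+ y) :* d′ :+ y :* d)) refl

theorem3p1 : ∀ {c ℓ} (R : RealField c ℓ) →
    let open RealField R in
    (a1 a2 b1 b2 : Carrier) → 0# < a1 → 0# < b1 →
    (n k : ℕ) → F R a1 a2 b1 b2 n k ≈ RHS R a1 a2 b1 b2 n k
theorem3p1 R a1 a2 b1 b2 0<a1 0<b1 = F≈coefficient*Δ R a2 b2 0<a1 0<b1
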